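{- There exists a 2-LFLP instance on which the approximation ratio of the 2-Chance Greedy Algorithm with discount factor $\gamma=1$ and opening cost scalar $\eta=2$ is at least $2.428$, i.e., the ratio of the cost of the algorithm's output to the optimal cost is at least $2.428$.
   Context: The 2-LFLP: an instance consists of locations $[n]$ with a metric $d$, facility opening costs $f_i\ge0$, and for every edge $e=(e_H,e_W)\in E:=[n]^2$ a number $\tau_e\ge0$ of individuals living at $e_H$ and working at $e_W$. Put $d(e,i)=\min\{d(e_H,i),d(e_W,i)\}$ and $\mathrm{Cost}(\mathrm{SOL})=\sum_{i\in\mathrm{SOL}}f_i+\sum_{e\in E}\tau_e\min_{i\in\mathrm{SOL}}d(e,i)$; $\mathrm{OPT}$ is a cost minimizer. 2-Chance Greedy Algorithm (parameters $\gamma\in[0,1]$, $\eta>0$; $x^+=\max\{x,0\}$): it maintains $\mathrm{SOL}=\emptyset$, $\alpha(e)=0$, $U=E$, and $\psi(e,L)=\bot$ for $e\in E$, $L\in\{H,W\}$. Time runs continuously and $\alpha(e)$ increases at unit rate for $e\in U$. Events are processed as they occur: (a) if $e\in U$, $i\in\mathrm{SOL}$, $\alpha(e)=d(e,i)$: remove $e$ from $U$ and set $\psi(e,L)=i$ for each $L$ with $\alpha(e)=d(e_L,i)$; (b) if $i\notin\mathrm{SOL}$ satisfies $\sum_{e\in U}\tau_e(\alpha(e)-d(e,i))^++\sum_{e\notin U}\sum_{L:\psi(e,L)=\bot}\tau_e(\gamma\alpha(e)-d(e_L,i))^+=\eta f_i$: add $i$ to $\mathrm{SOL}$, set $\psi(e,L)=i$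 for all $e\notin U$, $L$ with $\psi(e,L)=\bot$ and $\gamma\alpha(e)\ge d(e_L,i)$, then for every $e\in U$ with $\alpha(e)\ge d(e,i)$ remove $e$ from $U$ and set $\psi(e,L)=i$ for each $L$ with $\alpha(e)\ge d(e_L,i)$. Stop when $U=\emptyset$; output $\mathrm{SOL}$. -}

module Defs where

open import Data.Bool using (Bool; true; false; if_then_else_; _∧_; not)
open import Data.Nat using (ℕ)
open import Data.Fin using (Fin)
open import Data.Fin.Properties using () renaming (_≟_ to _≟ᶠ_)
open import Data.List using (List; foldr; map; allFin)
open import Data.Maybe using (Maybe; just; nothing; is-nothing)
open import Data.Product.Properties using ()
open import Data.Product using (_×_; _,_; Σ; proj₁; proj₂)
open import Data.Rational using (ℚ; 0ℚ; _+_; _-_; _*_; _⊓_; _⊔_; _≤_; _<_; _≤ᵇ_)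
open import Data.Rational.Properties using (_≟_)
open import Relation.Binary.PropositionalEquality using (_≡_; _≢_)
open import Relation.Nullary using (Dec)
open import Relation.Nullary.Decidable using (⌊_⌋)
open import Relation.Binary.Construct.Closure.ReflexiveTransitive using (Star)

∑ : {A : Set} → List A → (A → ℚ) → ℚ
∑ xs g = foldr (λ x acc → g x + acc) 0ℚ xs

_⁺ : ℚ → ℚ
x ⁺ = x ⊔ 0ℚ

record Instance : Set where
  field
    n    : ℕ
    d    : Fin n → Fin n → ℚ
    f    : Fin n → ℚ
    τ    : Fin n → Fin n → ℚ
    d-nonneg  : ∀ i j → 0ℚ ≤ d i j
    d-zero    : ∀ i → d i i ≡ 0ℚ
    d-ident   : ∀ i j → d i j ≡ 0ℚ → i ≡ j
    d-sym     : ∀ i j → d i j ≡ d j i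
    d-tri     : ∀ i j k → d i k ≤ d i j + d j k
    f-nonneg  : ∀ i → 0ℚ ≤ f i
    τ-nonneg  : ∀ h w → 0ℚ ≤ τ h w

data Side : Set where
  H W : Side

sides : List Side
sides = H Data.List.∷ W Data.List.∷ Data.List.[]

module _ (I : Instance) where
  open Instance I

  Edge : Set
  Edge = Fin n × Fin n

  edges : List Edge
  edges = Data.List.concatMap (λ h → map (λ w → (h , w)) (allFin n)) (allFin n)

  end : Edge → Side → Fin n
  end e H = proj₁ e
  end e W = proj₂ e

  τₑ : Edge → ℚ
  τₑ e = τ (proj₁ e) (proj₂ e)

  dE : Edge → Fin n → ℚ
  dE e i = d (end e H) i ⊓ d (end e W) i

  FacSet : Set
  FacSet = Fin n → Bool

  NonEmpty : FacSet → Set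
  NonEmpty S = Σ (Fin n) λ i → S i ≡ true

  minOver : FacSet → (Fin n → ℚ) → Maybe ℚ
  minOver S g = foldr step nothing (allFin n)
    where
    step : Fin n → Maybe ℚ → Maybe ℚ
    step i acc = if S i
                 then just (Data.Maybe.maybe (λ m → g i ⊓ m) (g i) acc)
                 else acc

  -- Cost(S) = Σ_{i∈S} f_i + Σ_e τ_e min_{i∈S} d(e,i)
  -- (only used for nonempty S; for S = ∅ the connection term is taken as 0)
  Cost : FacSet → ℚ
  Cost S = ∑ (allFin n) (λ i → if S i then f i else 0ℚ)
         + ∑ edges (λ e → τₑ e * Data.Maybe.fromMaybe 0ℚ (minOver S (dE e)))

  IsOptimal : FacSet → Set
  IsOptimal S = NonEmpty S × (∀ S' → NonEmpty S' → Cost S ≤ Cost S')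

  record State : Set where
    field
      sol : FacSet
      α   : Edge → ℚ
      inU : Edge → Bool
      ψ   : Edge → Side → Maybe (Fin n) -- ψ(e,L), nothing = ⊥

  open State public

  initial : State
  initial = record { sol = λ _ → false ; α = λ _ → 0ℚ
                   ; inU = λ _ → true ; ψ = λ _ _ → nothing }

  _≡ᵇ_ : ℚ → ℚ → Bool
  x ≡ᵇ y = ⌊ x ≟ y ⌋

  module Algorithm (γ η : ℚ) where

    bid : State → Fin n → ℚ
    bid s i = ∑ edges λ e →
      if inU s e
      then τₑ e * (α s e - dE e i) ⁺
      else ∑ sides (λ L → if is-nothing (ψ s e L)
                          then τₑ e * (γ * α s e - d (end e L) i) ⁺
                          else 0ℚ)

    EventA : State → Edge → Fin n → Set
    EventA s e i = inU s e ≡ true × sol s i ≡ true × α s e ≡ dE e i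

    EventB : State → Fin n → Set
    EventB s i = sol s i ≡ false × bid s i ≡ η * f i

    NoEvent : State → Set
    NoEvent s = (∀ e i → inU s e ≡ true → sol s i ≡ true → α s e ≢ dE e i)
              × (∀ i → sol s i ≡ false → bid s i ≢ η * f i)

    UNonEmpty : State → Set
    UNonEmpty s = Σ Edge λ e → inU s e ≡ true

    UEmpty : State → Set
    UEmpty s = ∀ e → inU s e ≡ false

    advance : State → ℚ → State
    advance s δ = record s { α = λ e → if inU s e then α s e + δ else α s e }

    processA : State → Edge → Fin n → State
    processA s e i = record s
      { inU = λ e' → if ⌊ edgeEq e' e ⌋ then false else inU s e'
      ; ψ   = λ e' L → if ⌊ edgeEq e' e ⌋ ∧ (α s e ≡ᵇ d (end e L) i)
                       then just i else ψ s e' L }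
      where
      edgeEq : (a b : Edge) → Relation.Nullary.Dec (a ≡ b)
      edgeEq a b = Data.Product.Properties.≡-dec _≟ᶠ_ _≟ᶠ_ a b

    processB : State → Fin n → State
    processB s i = record
      { sol = λ j → if ⌊ j ≟ᶠ i ⌋ then true else sol s j
      ; α   = α s
      ; inU = λ e → inU s e ∧ not (dE e i ≤ᵇ α s e)
      ; ψ   = λ e L →
          if not (inU s e) ∧ is-nothing (ψ s e L) ∧ (d (end e L) i ≤ᵇ γ * α s e)
          then just i
          else if inU s e ∧ (dE e i ≤ᵇ α s e) ∧ (d (end e L) i ≤ᵇ α s e)
          then just i
          else ψ s e L }

    -- one step of an execution; the algorithm only acts while U ≠ ∅.
    -- Time may only advance over an interval [t, t+δ) on which no event
    -- occurs (events are processed as they occur).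
    data Step : State → State → Set where
      time  : ∀ {s} → UNonEmpty s → (δ : ℚ) → 0ℚ < δ →
              (∀ δ' → 0ℚ ≤ δ' → δ' < δ → NoEvent (advance s δ')) →
              Step s (advance s δ)
      evA   : ∀ {s} → UNonEmpty s → (e : Edge) (i : Fin n) → EventA s e i →
              Step s (processA s e i)
      evB   : ∀ {s} → UNonEmpty s → (i : Fin n) → EventB s i →
              Step s (processB s i)

    Run : State → Set
    Run s = Star Step initial s × UEmpty s

-- Points 0 = x₀ < x₁ < ⋯ < x₁₇₁ on a line; x₀ carries a free facility, x₁₇₁ one of cost F and every
-- other point a very expensive one, and w_p individuals live and work at x_p. The greedy algorithm
-- opens x₀ at time 0 and afterwards only connects: at time x_j the individuals at x_j reach x₀, and
-- between two consecutive such times no other facility collects its threshold η f (one finite check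
-- per interval). So it pays Σ w_p x_p, whereas opening only x₁₇₁ costs F + Σ w_p (x₁₇₁ − x_p) and is
-- optimal, since any other solution opens an expensive facility or uses only the two ends. Evaluating
-- both costs gives the ratio 2.428.

module Submission where

open import Defs
open import Data.Bool using (true; false; not; _∧_; if_then_else_)
open import Data.Bool.Properties using (T-≡; ¬-not; not-injective) renaming (_≟_ to _≟ᵇ_)
open import Data.Empty using (⊥-elim)
open import Data.Fin using (Fin; zero; suc; fromℕ)
open import Data.Fin.Properties using (any?) renaming (_≟_ to _≟ᶠ_)
open import Data.List using (List; []; _∷_; _++_; map; concatMap; allFin; foldr; lookup; length)
open import Data.List.Membership.Propositional using (_∈_)
open import Data.List.Membership.Propositional.Properties using (∈-allFin; ∈-lookup; ∈-map⁺; ∈-concatMap⁺)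
open import Data.List.Relation.Unary.All as All using (All; []; _∷_)
open import Data.List.Relation.Unary.AllPairs as AllPairs using (AllPairs; _∷_)
open import Data.List.Relation.Unary.Any as Any using (here; there; index)
open import Data.List.Relation.Unary.Any.Properties using (lookup-index)
open import Data.List.Relation.Unary.Linked as Linked using (Linked; _∷_; linked?)
open import Data.List.Relation.Unary.Linked.Properties using (Linked⇒AllPairs)
open import Data.List.Relation.Unary.Unique.Propositional using (Unique)
open import Data.List.Relation.Unary.Unique.Propositional.Properties using (allFin⁺)
open import Data.Maybe using (Maybe; just; nothing; fromMaybe; maybe; is-nothing)
import Data.Maybe.Relation.Unary.All as Maybe
open import Data.Nat using (ℕ; suc)
open import Data.Product using (Σ; ∃; _×_; _,_; proj₁; proj₂)
open import Data.Product.Properties using (≡-dec)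
open import Data.Rational
  using (ℚ; 0ℚ; 1ℚ; _/_; _+_; _-_; _*_; _⊓_; _≤_; _<_; _≤ᵇ_; ∣_∣; -_; nonNegative)
open import Data.Rational.Properties
open import Algebra.Properties.AbelianGroup +-0-abelianGroup
  using (xyx⁻¹≈y; x∙y⁻¹≈ε⇒x≈y; ⁻¹-anti-homo‿-)
open import Data.Rational.Solver using (module +-*-Solver)
open import Data.Sum using (_⊎_; inj₁; inj₂)
open import Function using (_∘_; id; case_of_; Equivalence)
open import Relation.Binary.Construct.Closure.ReflexiveTransitive using (Star; ε; _◅_; _◅◅_)
open import Relation.Binary.Definitions using (tri<; tri≈; tri>)
open import Relation.Binary.PropositionalEquality
open import Relation.Nullary using (Dec; yes; no; contradiction)
open import Relation.Nullary.Decidable using (⌊_⌋; from-yes; _×-dec_; ¬?)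

p≤p+q : ∀ p {q} → 0ℚ ≤ q → p ≤ p + q
p≤p+q p {q} 0≤q = subst (_≤ p + q) (+-identityʳ p) (+-monoʳ-≤ p 0≤q)

p≤q+p : ∀ p {q} → 0ℚ ≤ q → p ≤ q + p
p≤q+p p {q} 0≤q = subst (_≤ q + p) (+-identityˡ p) (+-monoˡ-≤ p 0≤q)

*-monoˡ-≤ : ∀ {c p q} → 0ℚ ≤ c → p ≤ q → c * p ≤ c * q
*-monoˡ-≤ {c} 0≤c = *-monoˡ-≤-nonNeg c {{nonNegative 0≤c}}

*-nonneg : ∀ {p q} → 0ℚ ≤ p → 0ℚ ≤ q → 0ℚ ≤ p * q
*-nonneg {p} 0≤p 0≤q = subst (_≤ p * _) (*-zeroʳ p) (*-monoˡ-≤ 0≤p 0≤q)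

⁺-nonneg : ∀ x → 0ℚ ≤ x ⁺
⁺-nonneg x = p≤q⊔p x 0ℚ

⁺-mono : ∀ {x y} → x ≤ y → x ⁺ ≤ y ⁺
⁺-mono = ⊔-monoˡ-≤ 0ℚ

p+[q-p]≡q : ∀ p q → p + (q - p) ≡ q
p+[q-p]≡q p q = trans (sym (+-assoc p q (- p))) (xyx⁻¹≈y p q)

p-q≤p : ∀ p {q} → 0ℚ ≤ q → p - q ≤ p
p-q≤p p {q} 0≤q = subst (p - q ≤_) (+-identityʳ p) (+-monoʳ-≤ p (neg-antimono-≤ 0≤q))

p<q⇒0<q-p : ∀ {p q} → p < q → 0ℚ < q - p
p<q⇒0<q-p {p} {q} p<q = subst (_< q - p) (+-inverseʳ p) (+-monoˡ-< (- p) p<q)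

≤ᵇ-complete : ∀ {p q} → p ≤ q → (p ≤ᵇ q) ≡ true
≤ᵇ-complete = Equivalence.to T-≡ ∘ ≤⇒≤ᵇ

≤ᵇ-sound : ∀ p q → (p ≤ᵇ q) ≡ true → p ≤ q
≤ᵇ-sound p q = ≤ᵇ⇒≤ ∘ Equivalence.from T-≡

≤ᵇ≡false⇒> : ∀ {p q} → (p ≤ᵇ q) ≡ false → q < p
≤ᵇ≡false⇒> p≰ᵇq = ≰⇒> λ p≤q → contradiction (trans (sym p≰ᵇq) (≤ᵇ-complete p≤q)) λ ()

>⇒≤ᵇ≡false : ∀ {p q} → q < p → (p ≤ᵇ q) ≡ false
>⇒≤ᵇ≡false {p} {q} q<p = ¬-not λ p≤ᵇq → <-irrefl refl (<-≤-trans q<p (≤ᵇ-sound p q p≤ᵇq))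

≤⇒≡⊎< : ∀ {p q} → p ≤ q → p ≡ q ⊎ p < q
≤⇒≡⊎< {p} {q} p≤q with <-cmp p q
... | tri< p<q _ _ = inj₂ p<q
... | tri≈ _ p≡q _ = inj₁ p≡q
... | tri> _ _ p>q = ⊥-elim (<-irrefl refl (<-≤-trans p>q p≤q))

≤∧≢⇒< : ∀ {p q} → p ≤ q → p ≢ q → p < q
≤∧≢⇒< p≤q p≢q with ≤⇒≡⊎< p≤q
... | inj₁ p≡q = ⊥-elim (p≢q p≡q)
... | inj₂ p<q = p<q

∈-∷-above : ∀ {x y ys} → x ∈ y ∷ ys → y < x → x ∈ ys
∈-∷-above (here x≡y)   y<x = ⊥-elim (<-irrefl (sym x≡y) y<x)
∈-∷-above (there x∈ys) _   = x∈ys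

head-≤ : ∀ {x y ys} → All (y <_) ys → x ∈ y ∷ ys → y ≤ x
head-≤ _    (here x≡y)   = ≤-reflexive (sym x≡y)
head-≤ y<ys (there x∈ys) = <⇒≤ (All.lookup y<ys x∈ys)

lookup-injective : ∀ {A : Set} {xs : List A} → Unique xs → ∀ {i j} → lookup xs i ≡ lookup xs j → i ≡ j
lookup-injective (_ ∷ _)     {zero}  {zero}  _  = refl
lookup-injective (x∉xs ∷ _)  {zero}  {suc j} eq = ⊥-elim (All.lookup x∉xs (∈-lookup j) eq)
lookup-injective (x∉xs ∷ _)  {suc i} {zero}  eq = ⊥-elim (All.lookup x∉xs (∈-lookup i) (sym eq))
lookup-injective (_ ∷ xs!)   {suc i} {suc j} eq = cong suc (lookup-injective xs! eq)

-- Finite sums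

module _ {A : Set} where

  ∑-cong : ∀ xs {g h : A → ℚ} → (∀ x → g x ≡ h x) → ∑ xs g ≡ ∑ xs h
  ∑-cong []       g≡h = refl
  ∑-cong (x ∷ xs) g≡h = cong₂ _+_ (g≡h x) (∑-cong xs g≡h)

  ∑-mono : ∀ xs {g h : A → ℚ} → (∀ x → g x ≤ h x) → ∑ xs g ≤ ∑ xs h
  ∑-mono []       g≤h = ≤-refl
  ∑-mono (x ∷ xs) g≤h = +-mono-≤ (g≤h x) (∑-mono xs g≤h)

  ∑-nonneg : ∀ xs {g : A → ℚ} → (∀ x → 0ℚ ≤ g x) → 0ℚ ≤ ∑ xs g
  ∑-nonneg []       g≥0 = ≤-refl
  ∑-nonneg (x ∷ xs) g≥0 = +-mono-≤ (g≥0 x) (∑-nonneg xs g≥0)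

  ∑-zero : ∀ {xs} {g : A → ℚ} → All (λ x → g x ≡ 0ℚ) xs → ∑ xs g ≡ 0ℚ
  ∑-zero []           = refl
  ∑-zero (gx≡0 ∷ gxs) = cong₂ _+_ gx≡0 (∑-zero gxs)

  term≤∑ : ∀ {xs y} {g : A → ℚ} → (∀ x → 0ℚ ≤ g x) → y ∈ xs → g y ≤ ∑ xs g
  term≤∑ {x ∷ xs} {g = g} g≥0 (here refl) = p≤p+q (g x) (∑-nonneg xs g≥0)
  term≤∑ {x ∷ xs} {g = g} g≥0 (there y∈xs) = ≤-trans (term≤∑ g≥0 y∈xs) (p≤q+p (∑ xs g) (g≥0 x))

  ∑-single : ∀ {xs y} {g : A → ℚ} → Unique xs → y ∈ xs → (∀ x → x ≢ y → g x ≡ 0ℚ) →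
             ∑ xs g ≡ g y
  ∑-single {y ∷ xs} {g = g} (y∉xs ∷ _) (here refl) g≡0 = begin
    g y + ∑ xs g ≡⟨ cong (g y +_) (∑-zero (All.map (λ y≢x → g≡0 _ (≢-sym y≢x)) y∉xs)) ⟩
    g y + 0ℚ     ≡⟨ +-identityʳ (g y) ⟩
    g y          ∎
    where open ≡-Reasoning
  ∑-single {x ∷ xs} {y} {g} (x∉xs ∷ xs!) (there y∈xs) g≡0 = begin
    g x + ∑ xs g ≡⟨ cong₂ _+_ (g≡0 x (All.lookup x∉xs y∈xs)) (∑-single xs! y∈xs g≡0) ⟩
    0ℚ + g y     ≡⟨ +-identityˡ (g y) ⟩
    g y          ∎
    where open ≡-Reasoning

  ∑-++ : ∀ xs ys (g : A → ℚ) → ∑ (xs ++ ys) g ≡ ∑ xs g + ∑ ys g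
  ∑-++ []       ys g = sym (+-identityˡ _)
  ∑-++ (x ∷ xs) ys g = trans (cong (g x +_) (∑-++ xs ys g)) (sym (+-assoc (g x) _ _))

∑-map : ∀ {A B : Set} (f : A → B) xs (g : B → ℚ) → ∑ (map f xs) g ≡ ∑ xs (g ∘ f)
∑-map f []       g = refl
∑-map f (x ∷ xs) g = cong (g (f x) +_) (∑-map f xs g)

∑-concatMap : ∀ {A B : Set} (f : A → List B) xs (g : B → ℚ) →
              ∑ (concatMap f xs) g ≡ ∑ xs (λ x → ∑ (f x) g)
∑-concatMap f []       g = refl
∑-concatMap f (x ∷ xs) g = trans (∑-++ (f x) (concatMap f xs) g) (cong (∑ (f x) g +_) (∑-concatMap f xs g))

module _ (I : Instance) where
  open Instance I

  ∈-edges : ∀ e → e ∈ edges I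
  ∈-edges (a , b) = ∈-concatMap⁺ (λ h → map (h ,_) (allFin n))
                      (Any.map (λ { refl → ∈-map⁺ (a ,_) (∈-allFin b) }) (∈-allFin a))

  ∑-edges-diagonal : (g : Edge I → ℚ) → (∀ a b → a ≢ b → g (a , b) ≡ 0ℚ) →
                     ∑ (edges I) g ≡ ∑ (allFin n) (λ p → g (p , p))
  ∑-edges-diagonal g g≡0 = begin
    ∑ (edges I) g                                       ≡⟨ ∑-concatMap row (allFin n) g ⟩
    ∑ (allFin n) (λ a → ∑ (row a) g)                    ≡⟨ ∑-cong (allFin n) (λ a → ∑-map (a ,_) (allFin n) g) ⟩
    ∑ (allFin n) (λ a → ∑ (allFin n) (λ b → g (a , b))) ≡⟨ ∑-cong (allFin n) diagonal ⟩
    ∑ (allFin n) (λ p → g (p , p))                      ∎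
    where
    open ≡-Reasoning
    row : Fin n → List (Edge I)
    row a = map (a ,_) (allFin n)
    diagonal : ∀ a → ∑ (allFin n) (λ b → g (a , b)) ≡ g (a , a)
    diagonal a = ∑-single (allFin⁺ n) (∈-allFin a) (λ b b≢a → g≡0 a b (≢-sym b≢a))

-- Costs of solutions

module _ (I : Instance) where
  open Instance I

  dE-nonneg : ∀ e i → 0ℚ ≤ dE I e i
  dE-nonneg e i = ⊓-glb (d-nonneg _ _) (d-nonneg _ _)

  -- the fold that defines minOver, over an arbitrary list of candidates
  minStep : FacSet I → (Fin n → ℚ) → Fin n → Maybe ℚ → Maybe ℚ
  minStep S g i acc = if S i then just (maybe (λ m → g i ⊓ m) (g i) acc) else acc

  minOverList : FacSet I → (Fin n → ℚ) → List (Fin n) → Maybe ℚ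
  minOverList S g = foldr (minStep S g) nothing

  minOverList-≥ : ∀ {S g c} xs → (∀ i → S i ≡ true → c ≤ g i) → Maybe.All (c ≤_) (minOverList S g xs)
  minOverList-≥ [] c≤g = Maybe.nothing
  minOverList-≥ {S} {g} (x ∷ xs) c≤g with S x in Sx | minOverList S g xs | minOverList-≥ xs c≤g
  ... | false | _       | ih             = ih
  ... | true  | nothing | _              = Maybe.just (c≤g x Sx)
  ... | true  | just m  | Maybe.just c≤m = Maybe.just (⊓-glb (c≤g x Sx) c≤m)

  minOverList-≤ : ∀ {S g i} xs → i ∈ xs → S i ≡ true →
                  Σ ℚ λ m → minOverList S g xs ≡ just m × m ≤ g i
  minOverList-≤ {S} {g} (x ∷ xs) (here refl) Sx rewrite Sx with minOverList S g xs
  ... | nothing = g x , refl , ≤-refl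
  ... | just m  = g x ⊓ m , refl , p⊓q≤p (g x) m
  minOverList-≤ {S} {g} (x ∷ xs) (there i∈xs) Si with minOverList-≤ xs i∈xs Si | S x
  ... | m , eq , m≤gi | false = m , eq , m≤gi
  ... | m , eq , m≤gi | true rewrite eq = g x ⊓ m , refl , ≤-trans (p⊓q≤q (g x) m) m≤gi

  minOver-≥ : ∀ {S g c} → NonEmpty I S → (∀ i → S i ≡ true → c ≤ g i) →
              c ≤ fromMaybe 0ℚ (minOver I S g)
  minOver-≥ {S} {g} {c} (i , Si) c≤g with minOverList-≤ {g = g} (allFin n) (∈-allFin i) Si
  ... | m , eq , _ = subst (λ x → c ≤ fromMaybe 0ℚ x) (sym eq)
                       (Maybe.drop-just (subst (Maybe.All (c ≤_)) eq (minOverList-≥ (allFin n) c≤g)))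

  minOver-≤ : ∀ {S g i} → S i ≡ true → fromMaybe 0ℚ (minOver I S g) ≤ g i
  minOver-≤ {S} {g} {i} Si with minOverList-≤ {g = g} (allFin n) (∈-allFin i) Si
  ... | m , eq , m≤gi = subst (λ x → fromMaybe 0ℚ x ≤ g i) (sym eq) m≤gi

  Singleton : FacSet I → Fin n → Set
  Singleton S i = S i ≡ true × (∀ j → S j ≡ true → j ≡ i)

  openingCost : FacSet I → ℚ
  openingCost S = ∑ (allFin n) (λ i → if S i then f i else 0ℚ)

  connectionCost : FacSet I → ℚ
  connectionCost S = ∑ (edges I) (λ e → τₑ I e * fromMaybe 0ℚ (minOver I S (dE I e)))

  ∑τ : (Edge I → ℚ) → ℚ
  ∑τ c = ∑ (edges I) (λ e → τₑ I e * c e)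

  openingCost-term-nonneg : ∀ (S : FacSet I) i → 0ℚ ≤ (if S i then f i else 0ℚ)
  openingCost-term-nonneg S i with S i
  ... | true  = f-nonneg i
  ... | false = ≤-refl

  openingCost-≥ : ∀ {S i} → S i ≡ true → f i ≤ openingCost S
  openingCost-≥ {S} {i} Si = subst (_≤ openingCost S) (cong (if_then f i else 0ℚ) Si)
                               (term≤∑ (openingCost-term-nonneg S) (∈-allFin i))

  openingCost-single : ∀ {S i} → Singleton S i → openingCost S ≡ f i
  openingCost-single {S} {i} (Si , only-i) =
    trans (∑-single (allFin⁺ n) (∈-allFin i) closed) (cong (if_then f i else 0ℚ) Si)
    where
    closed : ∀ j → j ≢ i → (if S j then f j else 0ℚ) ≡ 0ℚ
    closed j j≢i with S j in Sj
    ... | true  = ⊥-elim (j≢i (only-i j Sj))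
    ... | false = refl

  connectionCost-≥ : ∀ {S} c → NonEmpty I S → (∀ e i → S i ≡ true → c e ≤ dE I e i) →
                     ∑τ c ≤ connectionCost S
  connectionCost-≥ c ne c≤d = ∑-mono (edges I) (λ e → *-monoˡ-≤ (τ-nonneg _ _) (minOver-≥ ne (c≤d e)))

  connectionCost-single : ∀ {S i} → Singleton S i → connectionCost S ≡ ∑τ (λ e → dE I e i)
  connectionCost-single {S} {i} (Si , only-i) = ≤-antisym
    (∑-mono (edges I) (λ e → *-monoˡ-≤ (τ-nonneg _ _) (minOver-≤ Si)))
    (connectionCost-≥ (λ e → dE I e i) (i , Si) (λ e j Sj → ≤-reflexive (cong (dE I e) (sym (only-i j Sj)))))

  connectionCost-nonneg : ∀ {S} → NonEmpty I S → 0ℚ ≤ connectionCost S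
  connectionCost-nonneg ne =
    ∑-nonneg (edges I) λ e → *-nonneg (τ-nonneg _ _) (minOver-≥ ne λ i _ → dE-nonneg e i)

  f≤Cost : ∀ {S i} → S i ≡ true → f i ≤ Cost I S
  f≤Cost {S} {i} Si = ≤-trans (openingCost-≥ {S} Si) (p≤p+q (openingCost S) (connectionCost-nonneg (i , Si)))

  Cost-single : ∀ {S i} → Singleton S i → Cost I S ≡ f i + ∑τ (λ e → dE I e i)
  Cost-single S≡i = cong₂ _+_ (openingCost-single S≡i) (connectionCost-single S≡i)

  Cost-≥ : ∀ {S i} c → S i ≡ true → (∀ e j → S j ≡ true → c e ≤ dE I e j) →
           f i + ∑τ c ≤ Cost I S
  Cost-≥ {S} c Si c≤d = +-mono-≤ (openingCost-≥ {S} Si) (connectionCost-≥ c (_ , Si) c≤d)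

-- Runs of the greedy algorithm that open a single free facility

module GreedyRun (I : Instance) (γ η : ℚ) (q : Fin (Instance.n I))
                 (f-q : Instance.f I q ≡ 0ℚ)
                 (balanced : ∀ e → 0ℚ < τₑ I e → Instance.d I (proj₁ e) q ≡ Instance.d I (proj₂ e) q)
                 where
  open Instance I
  open Algorithm I γ η

  _≟ₑ_ : (a b : Edge I) → Dec (a ≡ b)
  _≟ₑ_ = ≡-dec _≟ᶠ_ _≟ᶠ_

  dE-balanced : ∀ e → 0ℚ < τₑ I e → ∀ L → dE I e q ≡ d (end I e L) q
  dE-balanced e τ>0 H = trans (cong (d (proj₁ e) q ⊓_) (sym (balanced e τ>0))) (⊓-idem _)
  dE-balanced e τ>0 W = trans (cong (_⊓ d (proj₂ e) q) (balanced e τ>0)) (⊓-idem _)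

  pendingShare : Fin n → ℚ → ℚ → Edge I → ℚ
  pendingShare i T T′ e = if ⌊ T <? dE I e q ⌋ then (T′ - dE I e i) ⁺ else 0ℚ

  -- for a run settled at time T, pendingBid i T T′ bounds the bid for i up to time T′
  pendingBid : Fin n → ℚ → ℚ → ℚ
  pendingBid i T T′ = ∑τ I (pendingShare i T T′)

  Quiet : ℚ → ℚ → Set
  Quiet T T′ = ∀ i → i ≢ q → pendingBid i T T′ < η * f i

  -- The run at time T; connections at distance exactly T may still be pending (Settled excludes them).
  -- connected-ψ is what keeps connected individuals out of all later bids.
  record OnSchedule (T : ℚ) (s : State I) : Set where
    field
      q-open          : sol s q ≡ true
      only-q          : ∀ i → sol s i ≡ true → i ≡ q
      unconnected-α   : ∀ e → inU s e ≡ true → α s e ≡ T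
      unconnected-far : ∀ e → inU s e ≡ true → T ≤ dE I e q
      far-unconnected : ∀ e → T < dE I e q → inU s e ≡ true
      connected-ψ     : ∀ e → inU s e ≡ false → 0ℚ < τₑ I e → ∀ L → is-nothing (ψ s e L) ≡ false

  Settled : ℚ → State I → Set
  Settled T s = OnSchedule T s × (∀ e → inU s e ≡ true → T < dE I e q)

  processA-inU-⊆ : ∀ s e e′ → inU (processA s e q) e′ ≡ true → inU s e′ ≡ true
  processA-inU-⊆ s e e′ with e′ ≟ₑ e
  ... | yes _ = λ ()
  ... | no _  = id

  processA-removes : ∀ s e → inU (processA s e q) e ≢ true
  processA-removes s e with e ≟ₑ e
  ... | yes _   = λ ()
  ... | no e≢e = ⊥-elim (e≢e refl)

  connect-OnSchedule : ∀ {T s e} → OnSchedule T s → inU s e ≡ true → α s e ≡ dE I e q →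
                       OnSchedule T (processA s e q)
  connect-OnSchedule {T} {s} {e} inv e∈U due = record
    { q-open          = q-open
    ; only-q          = only-q
    ; unconnected-α   = λ e′ → unconnected-α e′ ∘ processA-inU-⊆ s e e′
    ; unconnected-far = λ e′ → unconnected-far e′ ∘ processA-inU-⊆ s e e′
    ; far-unconnected = far
    ; connected-ψ     = ψ-set
    }
    where
    open OnSchedule inv
    far : ∀ e′ → T < dE I e′ q → inU (processA s e q) e′ ≡ true
    far e′ T<d with e′ ≟ₑ e
    ... | yes refl = ⊥-elim (<-irrefl (trans (sym (unconnected-α e e∈U)) due) T<d)
    ... | no _     = far-unconnected e′ T<d
    ψ-set : ∀ e′ → inU (processA s e q) e′ ≡ false → 0ℚ < τₑ I e′ → ∀ L →
            is-nothing (ψ (processA s e q) e′ L) ≡ false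
    ψ-set e′ e′∉U τ>0 L with e′ ≟ₑ e
    ... | no _     = connected-ψ e′ e′∉U τ>0 L
    ... | yes refl with α s e ≟ d (end I e L) q
    ...   | yes _   = refl
    ...   | no α≢d = ⊥-elim (α≢d (trans due (dE-balanced e τ>0 L)))

  record Connected (T : ℚ) (s s′ : State I) (done : Edge I → Set) : Set where
    field
      steps   : Star Step s s′
      on-time : OnSchedule T s′
      shrinks : ∀ e → inU s′ e ≡ true → inU s e ≡ true
      handled : ∀ e → done e → inU s′ e ≡ true → T ≢ dE I e q

  connect-if-due : ∀ {T} s e → OnSchedule T s → Σ (State I) λ s′ → Connected T s s′ (_≡ e)
  connect-if-due {T} s e inv with inU s e in e∈U | α s e ≟ dE I e q
  ... | false | _ = s , record { steps = ε ; on-time = inv ; shrinks = λ _ → id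
                              ; handled = λ { _ refl e∈U′ → contradiction (trans (sym e∈U) e∈U′) λ () } }
  ... | true | no not-due = s , record
    { steps   = ε
    ; on-time = inv
    ; shrinks = λ _ → id
    ; handled = λ { _ refl _ T≡d → not-due (trans (unconnected-α e e∈U) T≡d) }
    }
    where open OnSchedule inv
  ... | true | yes due = processA s e q , record
    { steps   = evA (e , e∈U) e q (e∈U , q-open , due) ◅ ε
    ; on-time = connect-OnSchedule inv e∈U due
    ; shrinks = processA-inU-⊆ s e
    ; handled = λ { _ refl e∈U′ → ⊥-elim (processA-removes s e e∈U′) }
    }
    where open OnSchedule inv

  connect-all-due : ∀ {T} es s → OnSchedule T s → Σ (State I) λ s′ → Connected T s s′ (_∈ es)
  connect-all-due [] s inv = s , record { steps = ε ; on-time = inv ; shrinks = λ _ → id ; handled = λ _ () }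
  connect-all-due {T} (e ∷ es) s inv with connect-if-due s e inv
  ... | s₁ , c₁ with connect-all-due es s₁ (Connected.on-time c₁)
  ...   | s₂ , c₂ = s₂ , record
    { steps   = Connected.steps c₁ ◅◅ Connected.steps c₂
    ; on-time = Connected.on-time c₂
    ; shrinks = λ e′ → Connected.shrinks c₁ e′ ∘ Connected.shrinks c₂ e′
    ; handled = handled
    }
    where
    handled : ∀ e′ → e′ ∈ e ∷ es → inU s₂ e′ ≡ true → T ≢ dE I e′ q
    handled e′ (here refl)   = Connected.handled c₁ e′ refl ∘ Connected.shrinks c₂ e′
    handled e′ (there e′∈es) = Connected.handled c₂ e′ e′∈es

  settle : ∀ {T} s → OnSchedule T s → Σ (State I) λ s′ → Star Step s s′ × Settled T s′
  settle s inv with connect-all-due (edges I) s inv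
  ... | s′ , c = s′ , Connected.steps c , Connected.on-time c ,
                 λ e e∈U → ≤∧≢⇒< (OnSchedule.unconnected-far (Connected.on-time c) e e∈U)
                                 (Connected.handled c e (∈-edges I e) e∈U)

  pendingShare-far : ∀ {i T T′ e} → T < dE I e q → pendingShare i T T′ e ≡ (T′ - dE I e i) ⁺
  pendingShare-far {T = T} {e = e} T<d with T <? dE I e q
  ... | yes _   = refl
  ... | no T≮d = contradiction T<d T≮d

  pendingShare-nonneg : ∀ i T T′ e → 0ℚ ≤ pendingShare i T T′ e
  pendingShare-nonneg i T T′ e with T <? dE I e q
  ... | yes _ = ⁺-nonneg (T′ - dE I e i)
  ... | no _  = ≤-refl

  pendingBid-mono : ∀ i T {T′ T″} → T′ ≤ T″ → pendingBid i T T′ ≤ pendingBid i T T″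
  pendingBid-mono i T {T′} {T″} T′≤T″ = ∑-mono (edges I) λ e → *-monoˡ-≤ (τ-nonneg _ _) (share-mono e)
    where
    share-mono : ∀ e → pendingShare i T T′ e ≤ pendingShare i T T″ e
    share-mono e with T <? dE I e q
    ... | yes _ = ⁺-mono (+-monoˡ-≤ (- dE I e i) T′≤T″)
    ... | no _  = ≤-refl

  connectedShare : State I → Fin n → Edge I → Side → ℚ
  connectedShare s i e L = if is-nothing (ψ s e L) then τₑ I e * (γ * α s e - d (end I e L) i) ⁺ else 0ℚ

  pendingBid-≤ : ∀ i T T′ → pendingBid i T T′ ≤ ∑τ I (λ _ → T′ ⁺)
  pendingBid-≤ i T T′ = ∑-mono (edges I) λ e → *-monoˡ-≤ (τ-nonneg _ _) (share-≤ e)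
    where
    share-≤ : ∀ e → pendingShare i T T′ e ≤ T′ ⁺
    share-≤ e with T <? dE I e q
    ... | yes _ = ⁺-mono (p-q≤p T′ (dE-nonneg I e i))
    ... | no _  = ⁺-nonneg T′

  bidSummand : State I → Fin n → Edge I → ℚ
  bidSummand s i e = if inU s e then τₑ I e * (α s e - dE I e i) ⁺ else ∑ sides (connectedShare s i e)

  bidSummand-unconnected : ∀ s δ i e → inU s e ≡ true →
                           bidSummand (advance s δ) i e ≡ τₑ I e * (α s e + δ - dE I e i) ⁺
  bidSummand-unconnected s δ i e e∈U =
    cong (λ b → if b then τₑ I e * ((if b then α s e + δ else α s e) - dE I e i) ⁺
                else ∑ sides (connectedShare (advance s δ) i e)) e∈U

  bidSummand-connected : ∀ {T} s → OnSchedule T s → ∀ δ i e → inU s e ≡ false →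
                         bidSummand (advance s δ) i e ≡ 0ℚ
  bidSummand-connected s inv δ i e e∉U =
    trans (cong (λ b → if b then τₑ I e * (α (advance s δ) e - dE I e i) ⁺
                       else ∑ sides (connectedShare (advance s δ) i e)) e∉U)
          (∑-zero {g = connectedShare (advance s δ) i e} (unpaid H ∷ unpaid W ∷ []))
    where
    unpaid : ∀ L → connectedShare (advance s δ) i e L ≡ 0ℚ
    unpaid L with ≤⇒≡⊎< (τ-nonneg (proj₁ e) (proj₂ e))
    ... | inj₂ 0<τ rewrite OnSchedule.connected-ψ inv e e∉U 0<τ L = refl
    ... | inj₁ 0≡τ with is-nothing (ψ s e L)
    ...   | true  = trans (cong (_* share) (sym 0≡τ)) (*-zeroˡ share)
      where
      share : ℚ
      share = (γ * α (advance s δ) e - d (end I e L) i) ⁺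
    ...   | false = refl

  bid-≤-pendingBid : ∀ {T s} → Settled T s → ∀ δ i → bid (advance s δ) i ≤ pendingBid i T (T + δ)
  bid-≤-pendingBid {T} {s} (inv , far) δ i = ∑-mono (edges I) summand-≤
    where
    summand-≤ : ∀ e → bidSummand (advance s δ) i e ≤ τₑ I e * pendingShare i T (T + δ) e
    summand-≤ e = by-status (inU s e) refl
      where
      -- matching on a copy of inU s e, unlike `with`, leaves the goal unnormalised
      by-status : ∀ b → inU s e ≡ b → bidSummand (advance s δ) i e ≤ τₑ I e * pendingShare i T (T + δ) e
      by-status true e∈U = ≤-reflexive (begin
        bidSummand (advance s δ) i e
          ≡⟨ bidSummand-unconnected s δ i e e∈U ⟩
        τₑ I e * (α s e + δ - dE I e i) ⁺
          ≡⟨ cong (λ a → τₑ I e * (a + δ - dE I e i) ⁺) (OnSchedule.unconnected-α inv e e∈U) ⟩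
        τₑ I e * (T + δ - dE I e i) ⁺
          ≡⟨ cong (τₑ I e *_) (sym (pendingShare-far {i} {T} {T + δ} (far e e∈U))) ⟩
        τₑ I e * pendingShare i T (T + δ) e  ∎)
        where open ≡-Reasoning
      by-status false e∉U = subst (_≤ _) (sym (bidSummand-connected s inv δ i e e∉U))
                                  (*-nonneg (τ-nonneg _ _) (pendingShare-nonneg i T (T + δ) e))

  α-advance : ∀ s δ e → inU s e ≡ true → α (advance s δ) e ≡ α s e + δ
  α-advance s δ e e∈U = cong (λ b → if b then α s e + δ else α s e) e∈U

  wait : ∀ {T T′ s} → Settled T s → T < T′ → Quiet T T′ → (∀ e → inU s e ≡ true → T′ ≤ dE I e q) →
         UNonEmpty s → Step s (advance s (T′ - T)) × OnSchedule T′ (advance s (T′ - T))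
  wait {T} {T′} {s} settled@(inv , far) T<T′ quiet reach nonempty =
    time nonempty (T′ - T) (p<q⇒0<q-p T<T′) no-event , on-time
    where
    open OnSchedule inv
    α-at : ∀ δ e → inU s e ≡ true → α (advance s δ) e ≡ T + δ
    α-at δ e e∈U = trans (α-advance s δ e e∈U) (cong (_+ δ) (unconnected-α e e∈U))
    no-event : ∀ δ → 0ℚ ≤ δ → δ < T′ - T → NoEvent (advance s δ)
    no-event δ _ δ<T′-T = no-connection , no-opening
      where
      T+δ<T′ : T + δ < T′
      T+δ<T′ = subst (T + δ <_) (p+[q-p]≡q T T′) (+-monoʳ-< T δ<T′-T)
      no-connection : ∀ e i → inU s e ≡ true → sol s i ≡ true → α (advance s δ) e ≢ dE I e i
      no-connection e i e∈U i-open α≡d with only-q i i-open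
      ... | refl = <-irrefl (trans (sym (α-at δ e e∈U)) α≡d) (<-≤-trans T+δ<T′ (reach e e∈U))
      no-opening : ∀ i → sol s i ≡ false → bid (advance s δ) i ≢ η * f i
      no-opening i i-closed bid≡ηf = <-irrefl bid≡ηf (begin-strict
        bid (advance s δ) i     ≤⟨ bid-≤-pendingBid settled δ i ⟩
        pendingBid i T (T + δ)  ≤⟨ pendingBid-mono i T (<⇒≤ T+δ<T′) ⟩
        pendingBid i T T′       <⟨ quiet i i≢q ⟩
        η * f i                 ∎)
        where
        open ≤-Reasoning
        i≢q : i ≢ q
        i≢q refl = contradiction (trans (sym i-closed) q-open) λ ()
    on-time : OnSchedule T′ (advance s (T′ - T))
    on-time = record
      { q-open          = q-open
      ; only-q          = only-q
      ; unconnected-α   = λ e e∈U → trans (α-at (T′ - T) e e∈U) (p+[q-p]≡q T T′)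
      ; unconnected-far = reach
      ; far-unconnected = λ e T′<d → far-unconnected e (<-trans T<T′ T′<d)
      ; connected-ψ     = connected-ψ
      }

  s₀ : State I
  s₀ = processB (initial I) q

  bid-initial : bid (initial I) q ≡ η * f q
  bid-initial = begin
    ∑ (edges I) (λ e → τₑ I e * (0ℚ - dE I e q) ⁺) ≡⟨ ∑-zero {xs = edges I} (All.tabulate λ {e} _ → nothing-paid e) ⟩
    0ℚ                                            ≡⟨ sym (*-zeroʳ η) ⟩
    η * 0ℚ                                        ≡⟨ cong (η *_) (sym f-q) ⟩
    η * f q                                       ∎
    where
    open ≡-Reasoning
    nothing-paid : ∀ e → τₑ I e * (0ℚ - dE I e q) ⁺ ≡ 0ℚ
    nothing-paid e = trans (cong (τₑ I e *_) (p≤q⇒p⊔q≡q (p-q≤p 0ℚ (dE-nonneg I e q))))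
                           (*-zeroʳ (τₑ I e))

  open-q : Step (initial I) s₀
  open-q = evB ((q , q) , refl) q (refl , bid-initial)

  s₀-settled : Settled 0ℚ s₀
  s₀-settled = on-time , far
    where
    far : ∀ e → inU s₀ e ≡ true → 0ℚ < dE I e q
    far e e∈U = ≤ᵇ≡false⇒> (not-injective e∈U)
    ψ-set : ∀ e → inU s₀ e ≡ false → 0ℚ < τₑ I e → ∀ L → is-nothing (ψ s₀ e L) ≡ false
    ψ-set e e∉U τ>0 L = cong₂ (λ a b → is-nothing (if a ∧ b then just q else nothing)) near side-near
      where
      near : (dE I e q ≤ᵇ 0ℚ) ≡ true
      near = not-injective e∉U
      side-near : (d (end I e L) q ≤ᵇ 0ℚ) ≡ true
      side-near = ≤ᵇ-complete (subst (_≤ 0ℚ) (dE-balanced e τ>0 L) (≤ᵇ-sound (dE I e q) 0ℚ near))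
    on-time : OnSchedule 0ℚ s₀
    on-time = record
      { q-open          = q-open
      ; only-q          = only-q
      ; unconnected-α   = λ _ _ → refl
      ; unconnected-far = λ e → <⇒≤ ∘ far e
      ; far-unconnected = λ e 0<d → cong not (>⇒≤ᵇ≡false 0<d)
      ; connected-ψ     = ψ-set
      }
      where
      q-open : sol s₀ q ≡ true
      q-open with q ≟ᶠ q
      ... | yes _  = refl
      ... | no q≢q = ⊥-elim (q≢q refl)
      only-q : ∀ i → sol s₀ i ≡ true → i ≡ q
      only-q i with i ≟ᶠ q
      ... | yes i≡q = λ _ → i≡q
      ... | no _    = λ ()

  run-from : ∀ {T} ts s → Settled T s → AllPairs _<_ (T ∷ ts) → Linked Quiet (T ∷ ts) →
             All (λ x → ∃ λ e → dE I e q ≡ x) ts → (∀ e → T < dE I e q → dE I e q ∈ ts) →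
             Σ (State I) λ s′ → Star Step s s′ × UEmpty s′ × Singleton I (sol s′) q
  run-from [] s (inv , far) _ _ _ covered =
    s , ε , (λ e → ¬-not λ e∈U → case covered e (far e e∈U) of λ ()) , (q-open , only-q)
    where open OnSchedule inv
  run-from {T} (T′ ∷ ts) s settled@(inv , far) ((T<T′ ∷ _) ∷ ↗@(T′<ts ∷ _)) (quiet ∷ quiets) ((e′ , d≡T′) ∷ attained) covered
    = let step , on-time      = wait settled T<T′ quiet reach (e′ , OnSchedule.far-unconnected inv e′ T<d′)
          s′ , steps , settled′ = settle _ on-time
          s″ , steps′ , done    = run-from ts s′ settled′ ↗ quiets attained covered′
      in  s″ , step ◅ steps ◅◅ steps′ , done
    where
    T<d′ : T < dE I e′ q
    T<d′ = subst (T <_) (sym d≡T′) T<T′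
    reach : ∀ e → inU s e ≡ true → T′ ≤ dE I e q
    reach e e∈U = head-≤ T′<ts (covered e (far e e∈U))
    covered′ : ∀ e → T′ < dE I e q → dE I e q ∈ ts
    covered′ e T′<d = ∈-∷-above (covered e (<-trans T<T′ T′<d)) T′<d

  greedy-opens-only-q : (grid : List ℚ) → Linked _<_ (0ℚ ∷ grid) → Linked Quiet (0ℚ ∷ grid) →
                        (∀ e → dE I e q ∈ 0ℚ ∷ grid) → All (λ x → ∃ λ e → dE I e q ≡ x) grid →
                        Σ (State I) λ s → Run s × Singleton I (sol s) q
  greedy-opens-only-q grid ascending quiet covers attained
    with run-from grid s₀ s₀-settled (Linked⇒AllPairs <-trans ascending) quiet attained
                  (λ e 0<d → ∈-∷-above (covers e) 0<d)
  ... | s , steps , empty , only = s , (open-q ◅ steps , empty) , only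


-- Instances on a line

module LineInstance (grid : List ℚ) (ascending : Linked _<_ (0ℚ ∷ grid))
                    (f w : Fin (suc (length grid)) → ℚ)
                    (f-nonneg : ∀ i → 0ℚ ≤ f i) (w-nonneg : ∀ p → 0ℚ ≤ w p) where

  Point : Set
  Point = Fin (suc (length grid))

  points : List Point
  points = allFin (suc (length grid))

  pos : Point → ℚ
  pos = lookup (0ℚ ∷ grid)

  centre : Point
  centre = zero

  pos-nonneg : ∀ p → 0ℚ ≤ pos p
  pos-nonneg zero    = ≤-refl
  pos-nonneg (suc p) =
    <⇒≤ (All.lookup (AllPairs.head (Linked⇒AllPairs <-trans ascending)) (∈-lookup {xs = grid} p))

  pos-injective : ∀ {a b} → pos a ≡ pos b → a ≡ b
  pos-injective = lookup-injective (AllPairs.map <⇒≢ (Linked⇒AllPairs <-trans ascending))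

  dist : Point → Point → ℚ
  dist a b = ∣ pos a - pos b ∣

  residents : Point → Point → ℚ
  residents a b = if ⌊ a ≟ᶠ b ⌋ then w a else 0ℚ

  dist-ident : ∀ a b → dist a b ≡ 0ℚ → a ≡ b
  dist-ident a b d≡0 = pos-injective (x∙y⁻¹≈ε⇒x≈y (pos a) (pos b) (∣p∣≡0⇒p≡0 _ d≡0))

  dist-sym : ∀ a b → dist a b ≡ dist b a
  dist-sym a b = trans (sym (∣-p∣≡∣p∣ (pos a - pos b))) (cong ∣_∣ (⁻¹-anti-homo‿- (pos a) (pos b)))

  dist-tri : ∀ a b c → dist a c ≤ dist a b + dist b c
  dist-tri a b c = subst (λ x → ∣ x ∣ ≤ dist a b + dist b c) (telescope (pos a) (pos b) (pos c))
                         (∣p+q∣≤∣p∣+∣q∣ (pos a - pos b) (pos b - pos c))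
    where
    open +-*-Solver
    telescope : ∀ x y z → (x - y) + (y - z) ≡ x - z
    telescope = solve 3 (λ x y z → (x :- y) :+ (y :- z) := x :- z) refl

  residents-nonneg : ∀ a b → 0ℚ ≤ residents a b
  residents-nonneg a b with a ≟ᶠ b
  ... | yes _ = w-nonneg a
  ... | no _  = ≤-refl

  residents-diagonal : ∀ {a b} → 0ℚ < residents a b → a ≡ b
  residents-diagonal {a} {b} 0<r with a ≟ᶠ b
  ... | yes a≡b = a≡b
  ... | no _    = ⊥-elim (<-irrefl refl 0<r)

  inst : Instance
  inst = record
    { n = suc (length grid) ; d = dist ; f = f ; τ = residents
    ; d-nonneg = λ a b → 0≤∣p∣ _
    ; d-zero   = λ a → cong ∣_∣ (+-inverseʳ (pos a))
    ; d-ident  = dist-ident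
    ; d-sym    = dist-sym
    ; d-tri    = dist-tri
    ; f-nonneg = f-nonneg
    ; τ-nonneg = residents-nonneg
    }

  ∑τ-diagonal : ∀ c → ∑τ inst c ≡ ∑ points (λ p → w p * c (p , p))
  ∑τ-diagonal c =
    trans (∑-edges-diagonal inst (λ e → τₑ inst e * c e) off-diagonal) (∑-cong points on-diagonal)
    where
    off-diagonal : ∀ a b → a ≢ b → residents a b * c (a , b) ≡ 0ℚ
    off-diagonal a b a≢b with a ≟ᶠ b
    ... | yes a≡b = ⊥-elim (a≢b a≡b)
    ... | no _    = *-zeroˡ (c (a , b))
    on-diagonal : ∀ p → residents p p * c (p , p) ≡ w p * c (p , p)
    on-diagonal p with p ≟ᶠ p
    ... | yes _  = refl
    ... | no p≢p = ⊥-elim (p≢p refl)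

  balanced : ∀ q e → 0ℚ < τₑ inst e → dist (proj₁ e) q ≡ dist (proj₂ e) q
  balanced q (a , b) 0<τ = cong (λ x → dist x q) (residents-diagonal 0<τ)

  dist-to-centre : ∀ p → dist p centre ≡ pos p
  dist-to-centre p = trans (cong ∣_∣ (+-identityʳ (pos p))) (0≤p⇒∣p∣≡p (pos-nonneg p))

  pos-on-grid : ∀ p → pos p ∈ 0ℚ ∷ grid
  pos-on-grid = ∈-lookup

  distances-on-grid : ∀ e → dE inst e centre ∈ 0ℚ ∷ grid
  distances-on-grid (a , b) with ⊓-sel (dist a centre) (dist b centre)
  ... | inj₁ d≡a = subst (_∈ 0ℚ ∷ grid) (sym (trans d≡a (dist-to-centre a))) (pos-on-grid a)
  ... | inj₂ d≡b = subst (_∈ 0ℚ ∷ grid) (sym (trans d≡b (dist-to-centre b))) (pos-on-grid b)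

  grid-attained : All (λ x → ∃ λ e → dE inst e centre ≡ x) grid
  grid-attained = All.tabulate λ x∈grid → let p = suc (index x∈grid) in
    (p , p) , trans (⊓-idem (dist p centre)) (trans (dist-to-centre p) (sym (lookup-index x∈grid)))

  only : Point → FacSet inst
  only o i = ⌊ i ≟ᶠ o ⌋

  only-singleton : ∀ o → Singleton inst (only o) o
  only-singleton o = self , at-most-o
    where
    self : only o o ≡ true
    self with o ≟ᶠ o
    ... | yes _  = refl
    ... | no o≢o = ⊥-elim (o≢o refl)
    at-most-o : ∀ i → only o i ≡ true → i ≡ o
    at-most-o i with i ≟ᶠ o
    ... | yes i≡o = λ _ → i≡o
    ... | no _    = λ ()

  costOfOnly : Point → ℚ
  costOfOnly i = f i + ∑ points (λ p → w p * dE inst (p , p) i)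

  Cost-only : ∀ {S i} → Singleton inst S i → Cost inst S ≡ costOfOnly i
  Cost-only {i = i} S≡i = trans (Cost-single inst S≡i) (cong (f i +_) (∑τ-diagonal (λ e → dE inst e i)))

  Cost-≥-on-line : ∀ {S i} c → S i ≡ true → (∀ e j → S j ≡ true → c e ≤ dE inst e j) →
                   f i + ∑ points (λ p → w p * c (p , p)) ≤ Cost inst S
  Cost-≥-on-line {i = i} c Si c≤d = subst (_≤ _) (cong (f i +_) (∑τ-diagonal c)) (Cost-≥ inst c Si c≤d)

  pairCostBound : Point → ℚ
  pairCostBound o = f o + ∑ points (λ p → w p * (dE inst (p , p) centre ⊓ dE inst (p , p) o))

  module Rival (o : Point) (b : ℚ) (inner-≥ : ∀ i → i ≢ centre → i ≢ o → b ≤ f i) where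

    Cost-≥-within-pair : ∀ {S} → NonEmpty inst S → (∀ i → S i ≡ true → i ≡ centre ⊎ i ≡ o) →
                             costOfOnly o ≤ pairCostBound o → costOfOnly o ≤ costOfOnly centre →
                             costOfOnly o ≤ Cost inst S
    Cost-≥-within-pair {S} (j , Sj) centre-or-o ≤pair ≤centre = by-rival (S o) refl
      where
      by-rival : ∀ o-open → S o ≡ o-open → costOfOnly o ≤ Cost inst S
      by-rival true So = ≤-trans ≤pair (Cost-≥-on-line (λ e → dE inst e centre ⊓ dE inst e o) So nearer)
        where
        nearer : ∀ e i → S i ≡ true → dE inst e centre ⊓ dE inst e o ≤ dE inst e i
        nearer e i Si with centre-or-o i Si
        ... | inj₁ refl = p⊓q≤p (dE inst e centre) (dE inst e o)
        ... | inj₂ refl = p⊓q≤q (dE inst e centre) (dE inst e o)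
      by-rival false S∌o = ≤-trans ≤centre (Cost-≥-on-line (λ e → dE inst e centre) Scentre
                                               (λ e i Si → ≤-reflexive (cong (dE inst e) (sym (only-centre i Si)))))
        where
        only-centre : ∀ i → S i ≡ true → i ≡ centre
        only-centre i Si with centre-or-o i Si
        ... | inj₁ i≡c  = i≡c
        ... | inj₂ refl = contradiction (trans (sym S∌o) Si) λ ()
        Scentre : S centre ≡ true
        Scentre = subst (λ i → S i ≡ true) (only-centre j Sj) Sj

    only-rival-optimal : costOfOnly o ≤ b → costOfOnly o ≤ pairCostBound o → costOfOnly o ≤ costOfOnly centre →
                         IsOptimal inst (only o)
    only-rival-optimal ≤b ≤pair ≤centre = (o , proj₁ (only-singleton o)) , λ S ne →
      subst (_≤ Cost inst S) (sym (Cost-only (only-singleton o))) (by-inner S ne (inner? S))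
      where
      Inner : FacSet inst → Point → Set
      Inner S i = S i ≡ true × i ≢ centre × i ≢ o
      inner? : ∀ S → Dec (∃ (Inner S))
      inner? S = any? λ i → (S i ≟ᵇ true) ×-dec (¬? (i ≟ᶠ centre) ×-dec ¬? (i ≟ᶠ o))
      by-inner : ∀ S → NonEmpty inst S → Dec (∃ (Inner S)) → costOfOnly o ≤ Cost inst S
      by-inner S _  (yes (i , Si , i≢c , i≢o)) =
        ≤-trans ≤b (≤-trans (inner-≥ i i≢c i≢o) (f≤Cost inst {S} Si))
      by-inner S ne (no no-inner) = Cost-≥-within-pair ne centre-or-o ≤pair ≤centre
        where
        centre-or-o : ∀ i → S i ≡ true → i ≡ centre ⊎ i ≡ o
        centre-or-o i Si with i ≟ᶠ centre | i ≟ᶠ o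
        ... | yes i≡c | _       = inj₁ i≡c
        ... | no _    | yes i≡o = inj₂ i≡o
        ... | no i≢c  | no i≢o  = ⊥-elim (no-inner (i , Si , i≢c , i≢o))

    module Greedy (γ η : ℚ) (0≤η : 0ℚ ≤ η) (f-centre : f centre ≡ 0ℚ) where
      open GreedyRun inst γ η centre f-centre (balanced centre)

      QuietOnLine : ℚ → ℚ → Set
      QuietOnLine T T′ = ∑ points (λ p → w p * pendingShare o T T′ (p , p)) < η * f o
                       × ∑ points (λ p → w p * T′ ⁺) < η * b

      quiet? : ∀ T T′ → Dec (QuietOnLine T T′)
      quiet? T T′ = (∑ points (λ p → w p * pendingShare o T T′ (p , p)) <? η * f o)
                    ×-dec (∑ points (λ p → w p * T′ ⁺) <? η * b)

      quiet-from-line : ∀ {T T′} → QuietOnLine T T′ → Quiet T T′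
      quiet-from-line {T} {T′} (rival-quiet , inner-quiet) i i≢c = by-facility i i≢c (i ≟ᶠ o)
        where
        by-facility : ∀ i → i ≢ centre → Dec (i ≡ o) → pendingBid i T T′ < η * f i
        by-facility i _ (yes refl) = subst (_< η * f o) (sym (∑τ-diagonal (pendingShare o T T′))) rival-quiet
        by-facility i i≢c (no i≢o) = begin-strict
          pendingBid i T T′                ≤⟨ pendingBid-≤ i T T′ ⟩
          ∑τ inst (λ _ → T′ ⁺)             ≡⟨ ∑τ-diagonal (λ _ → T′ ⁺) ⟩
          ∑ points (λ p → w p * T′ ⁺)      <⟨ inner-quiet ⟩
          η * b                            ≤⟨ *-monoˡ-≤ 0≤η (inner-≥ i i≢c i≢o) ⟩
          η * f i                          ∎
          where open ≤-Reasoning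

      greedy-opens-only-centre : Linked QuietOnLine (0ℚ ∷ grid) →
                                 Σ (State inst) λ s → Algorithm.Run inst γ η s × Singleton inst (sol s) centre
      greedy-opens-only-centre quiet =
        greedy-opens-only-q grid ascending (Linked.map (λ {T} {T′} → quiet-from-line {T} {T′}) quiet)
                            distances-on-grid grid-attained

      -- The concrete instance only supplies closed numerical checks; keeping every other step generic
      -- spares the type checker from unfolding sums over a concrete set of edges.
      greedy-ratio-≥ : ∀ c → Linked QuietOnLine (0ℚ ∷ grid) → 0ℚ < costOfOnly o → costOfOnly o ≤ b →
                       costOfOnly o ≤ pairCostBound o → costOfOnly o ≤ costOfOnly centre →
                       c * costOfOnly o ≤ costOfOnly centre →
                       Σ Instance λ I → Σ (State I) λ s → Algorithm.Run I γ η s ×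
                         Σ (FacSet I) λ S → IsOptimal I S × 0ℚ < Cost I S × c * Cost I S ≤ Cost I (sol s)
      greedy-ratio-≥ c quiet 0<cost ≤b ≤pair ≤centre gap =
        let s , run , centre-only = greedy-opens-only-centre quiet
            cost-rival            = Cost-only (only-singleton o)
        in  inst , s , run , only o , only-rival-optimal ≤b ≤pair ≤centre ,
            subst (0ℚ <_) (sym cost-rival) 0<cost ,
            subst₂ (λ x y → c * x ≤ y) (sym cost-rival) (sym (Cost-only centre-only)) gap

-- The instance

-- imported this late because +_ makes sections such as (x +_) above ambiguous
open import Data.Integer using (+_)

module Example where
  open import Data.Rational.Literals using (fromℤ)

  -- fromℤ rather than _/_, whose gcd normalisation is very slow to evaluate inside goals
  toℚ : ℕ → ℚ
  toℚ k = fromℤ (+ k)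

  grid : List ℚ
  grid = map toℚ (
    219472 ∷ 219742 ∷ 220013 ∷ 220287 ∷ 220562 ∷ 220838 ∷ 221117 ∷ 221397 ∷ 221679 ∷
    221963 ∷ 222249 ∷ 222536 ∷ 222826 ∷ 223117 ∷ 223410 ∷ 223705 ∷ 224002 ∷ 224301 ∷
    224601 ∷ 224904 ∷ 225209 ∷ 225515 ∷ 225824 ∷ 226135 ∷ 226447 ∷ 226762 ∷ 227079 ∷
    227398 ∷ 227719 ∷ 228042 ∷ 228368 ∷ 228695 ∷ 229025 ∷ 229357 ∷ 229691 ∷ 230027 ∷
    230366 ∷ 230707 ∷ 231050 ∷ 231396 ∷ 231744 ∷ 232094 ∷ 232447 ∷ 232802 ∷ 233160 ∷
    233520 ∷ 233883 ∷ 234248 ∷ 234615 ∷ 234986 ∷ 235358 ∷ 235734 ∷ 236112 ∷ 236492 ∷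
    236876 ∷ 237262 ∷ 237651 ∷ 238042 ∷ 238436 ∷ 238833 ∷ 239233 ∷ 239636 ∷ 240042 ∷
    240451 ∷ 240862 ∷ 241277 ∷ 241694 ∷ 242115 ∷ 242538 ∷ 242965 ∷ 243395 ∷ 243828 ∷
    244264 ∷ 244704 ∷ 245146 ∷ 245592 ∷ 246041 ∷ 246494 ∷ 246950 ∷ 247409 ∷ 247872 ∷
    248338 ∷ 248808 ∷ 249281 ∷ 249758 ∷ 250239 ∷ 250723 ∷ 251211 ∷ 251703 ∷ 252198 ∷
    252697 ∷ 253200 ∷ 253707 ∷ 254218 ∷ 254733 ∷ 255252 ∷ 255774 ∷ 256301 ∷ 256833 ∷
    257368 ∷ 257907 ∷ 258451 ∷ 258999 ∷ 259552 ∷ 260109 ∷ 260670 ∷ 261236 ∷ 261806 ∷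
    262381 ∷ 262961 ∷ 263545 ∷ 264134 ∷ 264728 ∷ 265327 ∷ 265930 ∷ 266539 ∷ 267152 ∷
    267771 ∷ 268395 ∷ 269024 ∷ 269658 ∷ 270297 ∷ 270942 ∷ 271592 ∷ 272248 ∷ 272909 ∷
    273576 ∷ 274249 ∷ 274927 ∷ 275611 ∷ 276301 ∷ 276997 ∷ 277699 ∷ 278407 ∷ 279121 ∷
    279841 ∷ 280567 ∷ 281300 ∷ 282040 ∷ 282785 ∷ 283538 ∷ 284297 ∷ 285063 ∷ 285835 ∷
    286615 ∷ 287401 ∷ 288195 ∷ 288995 ∷ 289803 ∷ 290618 ∷ 291441 ∷ 292271 ∷ 293109 ∷
    293954 ∷ 294807 ∷ 295668 ∷ 296537 ∷ 297414 ∷ 298299 ∷ 299193 ∷ 300094 ∷ 301005 ∷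
    301924 ∷ 302851 ∷ 303788 ∷ 304733 ∷ 305687 ∷ 306651 ∷ 307623 ∷ 308605 ∷ 309597 ∷ [])

  ascending : Linked _<_ (0ℚ ∷ grid)
  ascending = from-yes (linked? _<?_ (0ℚ ∷ grid))

  far-end : Fin 172
  far-end = fromℕ 171

  far-end-cost inner-cost : ℚ
  far-end-cost = toℚ 17000000000
  inner-cost   = toℚ 1000000000000

  weight : Fin 172 → ℚ
  weight p = if ⌊ p ≟ᶠ zero ⌋ then 0ℚ else if ⌊ p ≟ᶠ far-end ⌋ then toℚ 109820 else toℚ 354

  opening : Fin 172 → ℚ
  opening p = if ⌊ p ≟ᶠ zero ⌋ then 0ℚ else if ⌊ p ≟ᶠ far-end ⌋ then far-end-cost else inner-cost

  weight-nonneg : ∀ p → 0ℚ ≤ weight p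
  weight-nonneg p with p ≟ᶠ zero | p ≟ᶠ far-end
  ... | yes _ | _     = ≤-refl
  ... | no _  | yes _ = from-yes (0ℚ ≤? toℚ 109820)
  ... | no _  | no _  = from-yes (0ℚ ≤? toℚ 354)

  opening-nonneg : ∀ p → 0ℚ ≤ opening p
  opening-nonneg p with p ≟ᶠ zero | p ≟ᶠ far-end
  ... | yes _ | _     = ≤-refl
  ... | no _  | yes _ = from-yes (0ℚ ≤? far-end-cost)
  ... | no _  | no _  = from-yes (0ℚ ≤? inner-cost)

  inner-cost-≤ : ∀ i → i ≢ zero → i ≢ far-end → inner-cost ≤ opening i
  inner-cost-≤ i i≢c i≢f with i ≟ᶠ zero | i ≟ᶠ far-end
  ... | yes i≡c | _       = ⊥-elim (i≢c i≡c)
  ... | no _    | yes i≡f = ⊥-elim (i≢f i≡f)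
  ... | no _    | no _    = ≤-refl

  open LineInstance grid ascending opening weight opening-nonneg weight-nonneg public
  open Rival far-end inner-cost inner-cost-≤ public
  open Greedy 1ℚ (+ 2 / 1) (from-yes (0ℚ ≤? + 2 / 1)) refl public

  quiet : Linked QuietOnLine (0ℚ ∷ grid)
  quiet = from-yes (linked? quiet? (0ℚ ∷ grid))

  far-end-cost-pos : 0ℚ < costOfOnly far-end
  far-end-cost-pos = from-yes (0ℚ <? costOfOnly far-end)

  far-end-≤-inner : costOfOnly far-end ≤ inner-cost
  far-end-≤-inner = from-yes (costOfOnly far-end ≤? inner-cost)

  far-end-≤-pair : costOfOnly far-end ≤ pairCostBound far-end
  far-end-≤-pair = from-yes (costOfOnly far-end ≤? pairCostBound far-end)

  far-end-≤-centre : costOfOnly far-end ≤ costOfOnly centre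
  far-end-≤-centre = from-yes (costOfOnly far-end ≤? costOfOnly centre)

  ratio : + 2428 / 1000 * costOfOnly far-end ≤ costOfOnly centre
  ratio = from-yes (+ 2428 / 1000 * costOfOnly far-end ≤? costOfOnly centre)

proposition4p3 : Σ Instance λ I →
    Σ (State I) λ s → Algorithm.Run I 1ℚ (+ 2 / 1) s ×
    Σ (FacSet I) λ S → IsOptimal I S × 0ℚ < Cost I S ×
    (+ 2428 / 1000) * Cost I S ≤ Cost I (sol s)
proposition4p3 =
  greedy-ratio-≥ (+ 2428 / 1000) quiet far-end-cost-pos far-end-≤-inner far-end-≤-pair far-end-≤-centre ratio
  where open Example
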